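{- Let $a,b$ be integers with $\gcd(a,b)=1$, and let $j\ge 2$ be an integer. A positive integer $n$ satisfies $n^j\mid a^n-b^n$ if and only if its prime factorization can be written in the form $$n=p_1^{k_1}p_2^{k_2}\cdots p_r^{k_r}\qquad (r\ge 0,\ p_1<p_2<\dots<p_r \text{ primes},\ \text{all } k_i\ge 1),$$ where $p_1^{(j-1)k_1}$ divides $a-b$ if $p_1>2$, and divides $\operatorname{lcm}(a-b,a+b)$ if $p_1=2$; and $p_i^{(j-1)k_i}\mid a^{n_i}-b^{n_i}$ for $i=2,\dots,r$, where $n_i=p_1^{k_1}p_2^{k_2}\cdots p_{i-1}^{k_{i-1}}$. (The case $n=1$ corresponds to $r=0$.)
   Context: For integers $a,b$ and $j\ge 1$, $R^{(j)}_{a,b}$ denotes the set of positive integers $n$ such that $n^j$ divides $a^n-b^n$; the theorem describes $R^{(j)}_{a,b}$ for $j\ge 2$. -}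

module Defs where

open import Data.Nat as ℕ using (ℕ; _≤_; _<_)
open import Data.Nat.Primality using (Prime)
open import Data.Integer as ℤ using (ℤ; +_)
open import Data.Integer.Divisibility using (_∣_)
open import Data.Integer.LCM using (lcm)
open import Data.Product using (_×_; _,_; proj₁)
open import Data.List using (List; []; _∷_; map)
open import Data.List.Relation.Unary.All using (All)
open import Data.List.Relation.Unary.Linked using (Linked)
open import Data.Unit using (⊤)
open import Relation.Binary.PropositionalEquality using (_≡_)

-- A candidate factorization is a list of pairs (pᵢ , kᵢ), read as
-- n = p₁^k₁ · p₂^k₂ ⋯ pᵣ^kᵣ  (the empty list, r = 0, gives n = 1).
Factors : Set
Factors = List (ℕ × ℕ)

factorProduct : Factors → ℕ
factorProduct []             = 1
factorProduct ((p , k) ∷ fs) = p ℕ.^ k ℕ.* factorProduct fs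

IsPrimeFactorization : ℕ → Factors → Set
IsPrimeFactorization n fs =
  n ≡ factorProduct fs
  × All (λ pk → Prime (Data.Product.proj₁ pk) × 1 ≤ Data.Product.proj₂ pk) fs
  × Linked _<_ (map proj₁ fs)

-- Conditions for i = 2..r, with m = nᵢ = p₁^k₁ ⋯ p_{i-1}^k_{i-1} the prefix product:
-- pᵢ^((j-1)kᵢ) ∣ a^{nᵢ} - b^{nᵢ}.
LaterConditions : ℤ → ℤ → ℕ → ℕ → Factors → Set
LaterConditions a b j m []             = ⊤
LaterConditions a b j m ((p , k) ∷ fs) =
  ((+ p) ℤ.^ ((j ℕ.∸ 1) ℕ.* k) ∣ (a ℤ.^ m) ℤ.- (b ℤ.^ m))
  × LaterConditions a b j (m ℕ.* p ℕ.^ k) fs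

FactorConditions : ℤ → ℤ → ℕ → Factors → Set
FactorConditions a b j []             = ⊤
FactorConditions a b j ((p , k) ∷ fs) =
  (2 < p → (+ p) ℤ.^ ((j ℕ.∸ 1) ℕ.* k) ∣ a ℤ.- b)
  × (p ≡ 2 → (+ p) ℤ.^ ((j ℕ.∸ 1) ℕ.* k) ∣ lcm (a ℤ.- b) (a ℤ.+ b))
  × LaterConditions a b j (p ℕ.^ k) fs

module Submission where

-- Write D m = aᵐ - bᵐ. Everything rests on a lifting-the-exponent analysis of D at one prime p,
-- obtained from D (M·t) = D M · Σ_{i<t} X^(t-1-i) Yⁱ with X = aᴹ, Y = bᴹ, and from the
-- expansions of this geometric sum modulo X - Y and modulo (X - Y)²:
--   * if p^e | D M with e ≥ 1 then p^(e+k) | D (M·pᵏ)                     (lift-power);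
--   * this is sharp for odd p, and for p = 2 above the index 2           (descend-odd, descend-two);
--   * factors of the index prime to p do not change the power of p       (drop-coprime);
--   * by Fermat's little theorem and Bézout, p | D n gives p | D (gcd(n, p - 1))   (D-order).
-- Sufficiency extends mʲ | D m one prime power at a time, m being the product of the earlier ones.
-- Necessity splits off least prime powers (sortedFactorisation); at a split n = m·pᵏ·r the prime p
-- divides D m because gcd(n, p - 1) | m, so p^(kj) | D (m·pᵏ), and descending yields the condition
-- at p; for p = 2, 2^((j-1)k+1) | D 2 = (a - b)(a + b) is the lcm condition.

open import Defs
open import Data.Empty using (⊥; ⊥-elim)
open import Data.Integer as ℤ using (ℤ; +_; 1ℤ; 0ℤ; _+_; _*_; _-_; -_; _^_)
import Data.Integer.DivMod as ℤ/
import Data.Integer.Divisibility as ℤU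
open import Data.Integer.Divisibility.Signed as ℤD using (_∣_; divides)
import Data.Integer.GCD as ℤG
open import Data.Integer.LCM using (lcm)
import Data.Integer.Properties as ℤP
open import Data.Integer.Tactic.RingSolver using (solve-∀)
open import Data.List using ([]; _∷_; map)
open import Data.List.Relation.Unary.All as All using (All; []; _∷_)
import Data.List.Relation.Unary.All.Properties as AllP
import Data.List.Relation.Unary.AllPairs as AllPairs
open import Data.List.Relation.Unary.Linked as Linked using (Linked; []; [-]; _∷_)
open import Data.List.Relation.Unary.Linked.Properties using (Linked⇒AllPairs)
open import Data.Nat as ℕ using (ℕ; zero; suc; _≤_; _<_; s≤s; z≤n; _!)
open import Data.Nat.Combinatorics using (_C_; nCk+nC[k+1]≡[n+1]C[k+1]; k>n⇒nCk≡0; nCn≡1; nCk≡n!/k![n-k]!; k![n∸k]!∣n!)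
open import Data.Nat.Coprimality using (Coprime; coprime-divisor)
open import Data.Nat.DivMod using (m/n*n≡m)
open import Data.Nat.Divisibility as ℕD using () renaming (_∣_ to _∣ₙ_; _∤_ to _∤ₙ_)
open import Data.Nat.Divisibility.Core using (hasNonTrivialDivisor)
import Data.Nat.GCD as ℕG
open import Data.Nat.Induction using (<-wellFounded)
import Data.Nat.LCM as ℕL
open import Data.Nat.Primality using (Prime; euclidsLemma; prime⇒nonTrivial; prime⇒irreducible; prime[2]; _Rough_;
  2-rough; rough⇒≤; ∤⇒rough-suc; rough∧∣⇒rough; rough∧∣⇒prime)
import Data.Nat.Properties as ℕP
import Data.Nat.Tactic.RingSolver as ℕRing
open import Data.Product using (∃-syntax; _×_; _,_; proj₁; proj₂)
open import Data.Sum using (_⊎_; inj₁; inj₂; [_,_]′)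
open import Data.Unit using (⊤; tt)
open import Function using (_∘_; id)
open import Function.Bundles using (_⇔_; mk⇔)
open import Induction.WellFounded using (Acc; acc)
open import Relation.Nullary using (¬_; yes; no)
open import Relation.Binary.PropositionalEquality

prime>1 : ∀ {p} → Prime p → 1 < p
prime>1 {p} pp = ℕ.nonTrivial⇒n>1 p {{prime⇒nonTrivial pp}}

-- Writing a prime as 2 + m lets definitions by recursion on p unfold.
prime≡2+ : ∀ {p} → Prime p → ∃[ m ] p ≡ 2 ℕ.+ m
prime≡2+ pp with prime>1 pp
... | s≤s (s≤s {n = m} _) = m , refl

prime∤! : ∀ {p} → Prime p → ∀ m → m < p → p ∤ₙ m !
prime∤! pp zero m<p p∣1 with prime>1 pp | ℕD.∣1⇒≡1 p∣1
... | s≤s () | refl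
prime∤! pp (suc m) m<p p∣m! with euclidsLemma (suc m) (m !) pp p∣m!
... | inj₁ p∣1+m = ℕP.<⇒≱ m<p (ℕD.∣⇒≤ p∣1+m)
... | inj₂ p∣m!  = prime∤! pp m (ℕP.<-trans (ℕP.n<1+n m) m<p) p∣m!

-- For 0 < k < p the prime p divides the binomial coefficient p C k, since
-- (p C k)·k!·(p-k)! = p! while p divides neither k! nor (p-k)!.
prime∣C : ∀ {p k} → Prime p → 0 < k → k < p → p ∣ₙ p C k
prime∣C {p} {k} pp 0<k k<p = fromProduct (euclidsLemma (p C k) (k ! ℕ.* (p ℕ.∸ k) !) pp p∣C*d)
  where
    instance _ = k ℕP.!* (p ℕ.∸ k) !≢0
    C*d≡p! : (p C k) ℕ.* (k ! ℕ.* (p ℕ.∸ k) !) ≡ p !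
    C*d≡p! = trans (cong (ℕ._* (k ! ℕ.* (p ℕ.∸ k) !)) (nCk≡n!/k![n-k]! (ℕP.<⇒≤ k<p))) (m/n*n≡m (k![n∸k]!∣n! (ℕP.<⇒≤ k<p)))
    p∣C*d : p ∣ₙ (p C k) ℕ.* (k ! ℕ.* (p ℕ.∸ k) !)
    p∣C*d with prime≡2+ pp
    ... | m , refl = subst (p ∣ₙ_) (sym C*d≡p!) (ℕD.∣m⇒∣m*n ((suc m) !) ℕD.∣-refl)
    fromProduct : p ∣ₙ (p C k) ⊎ p ∣ₙ k ! ℕ.* (p ℕ.∸ k) ! → p ∣ₙ p C k
    fromProduct (inj₁ p∣C) = p∣C
    fromProduct (inj₂ p∣d) with euclidsLemma (k !) ((p ℕ.∸ k) !) pp p∣d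
    ... | inj₁ p∣k!   = ⊥-elim (prime∤! pp k k<p p∣k!)
    ... | inj₂ p∣p-k! = ⊥-elim (prime∤! pp (p ℕ.∸ k) (ℕP.∸-monoʳ-< {p} {k} {0} 0<k (ℕP.<⇒≤ k<p)) p∣p-k!)

binomialSum : ℕ → ℕ → ℕ → ℕ
binomialSum x n zero    = 0
binomialSum x n (suc m) = binomialSum x n m ℕ.+ (n C m) ℕ.* x ℕ.^ m

binomialSum-pascal : ∀ x n m →
  binomialSum x (suc n) (suc m) ≡ binomialSum x n (suc m) ℕ.+ x ℕ.* binomialSum x n m
binomialSum-pascal x n zero = cong (binomialSum x n 1 ℕ.+_) (sym (ℕP.*-zeroʳ x))
binomialSum-pascal x n (suc m) = begin
    binomialSum x (suc n) (suc m) ℕ.+ (suc n C suc m) ℕ.* (x ℕ.* x ℕ.^ m)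
  ≡⟨ cong₂ (λ u v → u ℕ.+ v ℕ.* (x ℕ.* x ℕ.^ m)) (binomialSum-pascal x n m) (sym (nCk+nC[k+1]≡[n+1]C[k+1] n m)) ⟩
    (S₁ ℕ.+ x ℕ.* S₀) ℕ.+ ((n C m) ℕ.+ (n C suc m)) ℕ.* (x ℕ.* x ℕ.^ m)
  ≡⟨ regroup S₁ S₀ (n C m) (n C suc m) x (x ℕ.^ m) ⟩
    (S₁ ℕ.+ (n C suc m) ℕ.* (x ℕ.* x ℕ.^ m)) ℕ.+ x ℕ.* (S₀ ℕ.+ (n C m) ℕ.* x ℕ.^ m)
  ∎
  where
    open ≡-Reasoning
    S₀ = binomialSum x n m
    S₁ = binomialSum x n (suc m)
    regroup : ∀ A B c₁ c₂ x y →
      (A ℕ.+ x ℕ.* B) ℕ.+ (c₁ ℕ.+ c₂) ℕ.* (x ℕ.* y) ≡ (A ℕ.+ c₂ ℕ.* (x ℕ.* y)) ℕ.+ x ℕ.* (B ℕ.+ c₁ ℕ.* y)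
    regroup = ℕRing.solve-∀

binomial-theorem : ∀ x n → (suc x) ℕ.^ n ≡ binomialSum x n (suc n)
binomial-theorem x zero = refl
binomial-theorem x (suc n) = begin
    suc x ℕ.* suc x ℕ.^ n
  ≡⟨ cong (suc x ℕ.*_) (binomial-theorem x n) ⟩
    suc x ℕ.* S
  ≡⟨ expand S x ⟩
    (S ℕ.+ 0) ℕ.+ x ℕ.* S
  ≡⟨ cong (λ c → (S ℕ.+ c ℕ.* x ℕ.^ suc n) ℕ.+ x ℕ.* S) (sym (k>n⇒nCk≡0 {n} {suc n} ℕP.≤-refl)) ⟩
    binomialSum x n (2 ℕ.+ n) ℕ.+ x ℕ.* S
  ≡⟨ binomialSum-pascal x n (suc n) ⟨
    binomialSum x (suc n) (2 ℕ.+ n)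
  ∎
  where
    open ≡-Reasoning
    S = binomialSum x n (suc n)
    expand : ∀ A x → suc x ℕ.* A ≡ (A ℕ.+ 0) ℕ.+ x ℕ.* A
    expand = ℕRing.solve-∀

binomialSum-prime : ∀ {p} x m → Prime p → m < p → ∃[ w ] p ∣ₙ w × binomialSum x p (suc m) ≡ 1 ℕ.+ w
binomialSum-prime x zero pp _ = 0 , ℕD._∣0 _ , refl
binomialSum-prime {p} x (suc m) pp 1+m<p with binomialSum-prime x m pp (ℕP.<⇒≤ 1+m<p)
... | w , p∣w , eq = w ℕ.+ (p C suc m) ℕ.* x ℕ.^ suc m
                   , ℕD.∣m∣n⇒∣m+n p∣w (ℕD.∣m⇒∣m*n _ (prime∣C pp (s≤s z≤n) 1+m<p))
                   , trans (cong (ℕ._+ (p C suc m) ℕ.* x ℕ.^ suc m) eq) (ℕP.+-assoc 1 w _)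

-- Fermat's little theorem: xᵖ ≡ x (mod p), by induction on x via (1 + x)ᵖ ≡ 1 + xᵖ (mod p).
fermat : ∀ {p} → Prime p → ∀ x → ∃[ w ] p ∣ₙ w × x ℕ.^ p ≡ x ℕ.+ w
fermat pp zero with prime≡2+ pp
... | m , refl = 0 , ℕD._∣0 _ , refl
fermat pp (suc x) with prime≡2+ pp | fermat pp x
... | m , refl | w₂ , p∣w₂ , xᵖ≡x+w₂ with binomialSum-prime x (suc m) pp ℕP.≤-refl
... | w₁ , p∣w₁ , sum≡1+w₁ = w₁ ℕ.+ w₂ , ℕD.∣m∣n⇒∣m+n p∣w₁ p∣w₂ , eq
  where
    open ≡-Reasoning
    p = 2 ℕ.+ m
    eq : suc x ℕ.^ p ≡ suc x ℕ.+ (w₁ ℕ.+ w₂)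
    eq = begin
        suc x ℕ.^ p
      ≡⟨ binomial-theorem x p ⟩
        binomialSum x p p ℕ.+ (p C p) ℕ.* x ℕ.^ p
      ≡⟨ cong₂ (λ u v → u ℕ.+ v ℕ.* x ℕ.^ p) sum≡1+w₁ (nCn≡1 p) ⟩
        (1 ℕ.+ w₁) ℕ.+ 1 ℕ.* x ℕ.^ p
      ≡⟨ cong (λ u → (1 ℕ.+ w₁) ℕ.+ 1 ℕ.* u) xᵖ≡x+w₂ ⟩
        (1 ℕ.+ w₁) ℕ.+ 1 ℕ.* (x ℕ.+ w₂)
      ≡⟨ regroup w₁ x w₂ ⟩
        suc x ℕ.+ (w₁ ℕ.+ w₂)
      ∎
      where regroup : ∀ a b c → (1 ℕ.+ a) ℕ.+ 1 ℕ.* (b ℕ.+ c) ≡ suc b ℕ.+ (a ℕ.+ c)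
            regroup = ℕRing.solve-∀

prime∣prime^⇒≡ : ∀ {q p} → Prime q → Prime p → ∀ k → q ∣ₙ p ℕ.^ k → q ≡ p
prime∣prime^⇒≡ pq pp zero q∣1 with prime>1 pq | ℕD.∣1⇒≡1 q∣1
... | s≤s () | refl
prime∣prime^⇒≡ pq pp (suc k) q∣pᵏ⁺¹ with euclidsLemma _ _ pq q∣pᵏ⁺¹
... | inj₂ q∣pᵏ = prime∣prime^⇒≡ pq pp k q∣pᵏ
... | inj₁ q∣p with prime⇒irreducible pp q∣p
...   | inj₂ q≡p  = q≡p
...   | inj₁ refl with prime>1 pq
...     | s≤s ()

-- Searching upward from 2 for a divisor of r > 1 finds its least prime factor p, so r is p-rough.
leastPrimeFactor : ∀ r → 1 < r → ∃[ p ] Prime p × p ∣ₙ r × p Rough r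
leastPrimeFactor r 1<r = search (r ℕ.∸ 2) 2 (ℕP.m∸n+n≡m 1<r) ℕP.≤-refl 2-rough
  where
    search : ∀ k d → k ℕ.+ d ≡ r → 2 ≤ d → d Rough r → ∃[ p ] Prime p × p ∣ₙ r × p Rough r
    search k d k+d≡r 2≤d rough with d ℕD.∣? r
    ... | yes d∣r = d , rough∧∣⇒prime {{ℕ.n>1⇒nonTrivial 2≤d}} rough d∣r , d∣r , rough
    search zero    d refl 2≤d rough | no d∤r = ⊥-elim (d∤r ℕD.∣-refl)
    search (suc k) d k+d≡r 2≤d rough | no d∤r =
      search k (suc d) (trans (ℕP.+-suc k d) k+d≡r) (ℕP.m≤n⇒m≤1+n 2≤d) (∤⇒rough-suc d∤r rough)

1≤m*n⇒1≤m : ∀ m n → 1 ≤ m ℕ.* n → 1 ≤ m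
1≤m*n⇒1≤m (suc m) n _ = s≤s z≤n

factorOut : ∀ {p} → Prime p → ∀ r → 1 ≤ r → ∃[ k ] ∃[ r' ] r ≡ p ℕ.^ k ℕ.* r' × p ∤ₙ r'
factorOut {p} pp r 1≤r = go r 1≤r (<-wellFounded r)
  where
    rearrange : ∀ A p r → A ℕ.* r ℕ.* p ≡ p ℕ.* A ℕ.* r
    rearrange = ℕRing.solve-∀
    go : ∀ r → 1 ≤ r → Acc _<_ r → ∃[ k ] ∃[ r' ] r ≡ p ℕ.^ k ℕ.* r' × p ∤ₙ r'
    go r 1≤r (acc rec) with p ℕD.∣? r
    ... | no p∤r = 0 , r , sym (ℕP.*-identityˡ r) , p∤r
    ... | yes (ℕD.divides q refl)
      with go q (1≤m*n⇒1≤m q p 1≤r) (rec (ℕP.m<m*n q p {{ℕ.>-nonZero (1≤m*n⇒1≤m q p 1≤r)}} (prime>1 pp)))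
    ...   | k , r' , q≡pᵏr' , p∤r' = suc k , r' , trans (cong (ℕ._* p) q≡pᵏr') (rearrange (p ℕ.^ k) p r') , p∤r'

record LeastPrimePower (r : ℕ) : Set where
  field
    p k r'    : ℕ
    isPrime   : Prime p
    1≤k       : 1 ≤ k
    split     : r ≡ p ℕ.^ k ℕ.* r'
    p∤r'      : p ∤ₙ r'
    p∣r       : p ∣ₙ r
    p-rough   : p Rough r
    1≤r'      : 1 ≤ r'
    r'<r      : r' < r

leastPrimePower : ∀ r → 1 < r → LeastPrimePower r
leastPrimePower r 1<r with leastPrimeFactor r 1<r
... | p , pp , p∣r , rough with factorOut pp r (ℕP.<⇒≤ 1<r)
...   | zero  , r' , r≡1*r' , p∤r' = ⊥-elim (p∤r' (subst (p ∣ₙ_) (trans r≡1*r' (ℕP.*-identityˡ r')) p∣r))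
...   | suc k , zero , r≡pᵏ*0 , _ = ⊥-elim (ℕP.n≮0 (subst (1 <_) (trans r≡pᵏ*0 (ℕP.*-zeroʳ (p ℕ.^ suc k))) 1<r))
...   | suc k , suc r' , split , p∤r' = record
  { p = p ; k = suc k ; r' = suc r' ; isPrime = pp ; 1≤k = s≤s z≤n ; split = split ; p∤r' = p∤r'
  ; p∣r = p∣r ; p-rough = rough ; 1≤r' = s≤s z≤n
  ; r'<r = subst (suc r' <_) (trans (ℕP.*-comm (suc r') (p ℕ.^ suc k)) (sym split))
             (ℕP.m<m*n (suc r') (p ℕ.^ suc k) (ℕP.^-monoʳ-< p (prime>1 pp) {0} {suc k} (s≤s z≤n)))
  }

PrimesBelow : ℕ → ℕ → Set
PrimesBelow m s = ∀ {q} → Prime q → q ∣ₙ m → q < s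

primesBelow-1 : ∀ {s} → PrimesBelow 1 s
primesBelow-1 pq q∣1 with prime>1 pq | ℕD.∣1⇒≡1 q∣1
... | s≤s () | refl

primesBelow-≤ : ∀ {m s t} → PrimesBelow m s → s ≤ t → PrimesBelow m t
primesBelow-≤ below s≤t pq q∣m = ℕP.<-≤-trans (below pq q∣m) s≤t

primesBelow-* : ∀ {m s p} → PrimesBelow m s → Prime p → p < s → ∀ k → PrimesBelow (m ℕ.* p ℕ.^ k) s
primesBelow-* {m} {p = p} below pp p<s k pq q∣mpᵏ with euclidsLemma m (p ℕ.^ k) pq q∣mpᵏ
... | inj₁ q∣m  = below pq q∣m
... | inj₂ q∣pᵏ = subst (_< _) (sym (prime∣prime^⇒≡ pq pp k q∣pᵏ)) p<s

primesBelow⇒∤ : ∀ {m s p} → PrimesBelow m s → Prime p → s ≤ p → p ∤ₙ m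
primesBelow⇒∤ below pp s≤p p∣m = ℕP.<-irrefl refl (ℕP.<-≤-trans (below pp p∣m) s≤p)

primesBelow-2⇒≡1 : ∀ {m} → 1 ≤ m → PrimesBelow m 2 → m ≡ 1
primesBelow-2⇒≡1 {m} 1≤m below with ℕP.m≤n⇒m<n∨m≡n 1≤m
... | inj₂ 1≡m = sym 1≡m
... | inj₁ 1<m with leastPrimeFactor m 1<m
...   | q , pq , q∣m , _ = ⊥-elim (ℕP.<-irrefl refl (ℕP.<-≤-trans (prime>1 pq) (ℕP.≤-pred (below pq q∣m))))

-- Divisors of p - 1 are smaller than p, so for p-rough r the number gcd(m·r, p - 1) is
-- prime to r and therefore divides m.
gcd[mr,p-1]∣m : ∀ {p r} → Prime p → p Rough r → ∀ m → ℕG.gcd (m ℕ.* r) (p ℕ.∸ 1) ∣ₙ m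
gcd[mr,p-1]∣m {p} {r} pp rough m with prime≡2+ pp
... | p' , refl = coprime-divisor g⊥r (subst (g ∣ₙ_) (ℕP.*-comm m r) (ℕG.gcd[m,n]∣m (m ℕ.* r) (suc p')))
  where
    g = ℕG.gcd (m ℕ.* r) (suc p')
    g⊥r : Coprime g r
    g⊥r {zero} (0∣g , _) with ℕD.0∣⇒≡0 (ℕD.∣-trans 0∣g (ℕG.gcd[m,n]∣n (m ℕ.* r) (suc p')))
    ... | ()
    g⊥r {suc zero} _ = refl
    g⊥r {suc (suc i)} (i∣g , i∣r) =
      ⊥-elim (rough (hasNonTrivialDivisor (s≤s (ℕD.∣⇒≤ (ℕD.∣-trans i∣g (ℕG.gcd[m,n]∣n (m ℕ.* r) (suc p'))))) i∣r))

above-head : ∀ {x} (fs : Factors) → Linked _<_ (x ∷ map proj₁ fs) → All (λ pk → x < proj₁ pk) fs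
above-head fs increasing = AllP.map⁻ (AllPairs.head (Linked⇒AllPairs ℕP.<-trans increasing))

PrefixConditions : (ℕ → ℕ → ℕ → Set) → ℕ → Factors → Set
PrefixConditions Q m []             = ⊤
PrefixConditions Q m ((p , k) ∷ fs) = Q m p k × PrefixConditions Q (m ℕ.* p ℕ.^ k) fs

record SortedFactorisation (Q : ℕ → ℕ → ℕ → Set) (s m r : ℕ) : Set where
  field
    factors     : Factors
    product     : r ≡ factorProduct factors
    primePowers : All (λ pk → Prime (proj₁ pk) × 1 ≤ proj₂ pk) factors
    increasing  : Linked _<_ (map proj₁ factors)
    bounded     : All (λ pk → s ≤ proj₁ pk) factors
    conditions  : PrefixConditions Q m factors

-- Splitting off least prime powers one at a time factorises any N ≥ 1 in increasing order; if Q
-- holds at every such split N = m·pᵏ·r' (where m has only smaller primes), the factorisation satisfies Q.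
module _ (N : ℕ) (Q : ℕ → ℕ → ℕ → Set)
         (step : ∀ {m p k r} → N ≡ m ℕ.* (p ℕ.^ k ℕ.* r) → Prime p → 1 ≤ k → p ∤ₙ r →
                 p Rough (p ℕ.^ k ℕ.* r) → PrimesBelow m p → Q m p k) where

  sortedFactorisation : ∀ s m r → N ≡ m ℕ.* r → 1 ≤ r → s Rough r → PrimesBelow m s →
                        SortedFactorisation Q s m r
  sortedFactorisation s m r N≡mr 1≤r rough below = go s m r N≡mr 1≤r rough below (<-wellFounded r)
    where
      go : ∀ s m r → N ≡ m ℕ.* r → 1 ≤ r → s Rough r → PrimesBelow m s → Acc _<_ r → SortedFactorisation Q s m r
      go s m r N≡mr 1≤r rough below (acc rec) with ℕP.m≤n⇒m<n∨m≡n 1≤r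
      ... | inj₂ refl = record
        { factors = [] ; product = refl ; primePowers = [] ; increasing = [] ; bounded = [] ; conditions = tt }
      ... | inj₁ 1<r = record
        { factors     = (p , k) ∷ F.factors
        ; product     = trans split (cong (p ℕ.^ k ℕ.*_) F.product)
        ; primePowers = (isPrime , 1≤k) ∷ F.primePowers
        ; increasing  = linked F.factors F.bounded F.increasing
        ; bounded     = s≤p ∷ All.map (λ p<q → ℕP.≤-trans s≤p (ℕP.<⇒≤ p<q)) F.bounded
        ; conditions  = step N≡m[pᵏr'] isPrime 1≤k p∤r' p-rough' (primesBelow-≤ below s≤p)
                        , F.conditions
        }
        where
          open LeastPrimePower (leastPrimePower r 1<r)
          p-rough' : p Rough (p ℕ.^ k ℕ.* r')
          p-rough' = subst (p Rough_) split p-rough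
          s≤p : s ≤ p
          s≤p = rough⇒≤ {{prime⇒nonTrivial isPrime}} (rough∧∣⇒rough rough p∣r)
          N≡m[pᵏr'] : N ≡ m ℕ.* (p ℕ.^ k ℕ.* r')
          N≡m[pᵏr'] = trans N≡mr (cong (m ℕ.*_) split)
          linked : ∀ fs → All (λ pk → p < proj₁ pk) fs → Linked _<_ (map proj₁ fs) → Linked _<_ (p ∷ map proj₁ fs)
          linked []      _         _          = [-]
          linked (_ ∷ _) (p<q ∷ _) increasing = p<q ∷ increasing
          module F = SortedFactorisation
            (go (suc p) (m ℕ.* p ℕ.^ k) r' (trans N≡m[pᵏr'] (sym (ℕP.*-assoc m (p ℕ.^ k) r'))) 1≤r'
                (∤⇒rough-suc p∤r' (rough∧∣⇒rough p-rough (subst (r' ∣ₙ_) (sym split) (ℕD.n∣m*n (p ℕ.^ k)))))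
                (primesBelow-* (primesBelow-≤ below (ℕP.m≤n⇒m≤1+n s≤p)) isPrime (ℕP.n<1+n p) k)
                (rec r'<r))

*-pres-∣ : ∀ {k l x y} → k ∣ x → l ∣ y → k * l ∣ x * y
*-pres-∣ {k} {l} {x} {y} k∣x l∣y = ℤD.∣-trans (ℤD.*-monoˡ-∣ l k∣x) (ℤD.*-monoʳ-∣ x l∣y)

∣x-y∣y⇒∣x : ∀ {k x y} → k ∣ x - y → k ∣ y → k ∣ x
∣x-y∣y⇒∣x k∣x-y k∣y = ℤD.∣m+n∣n⇒∣m k∣x-y (ℤD.∣m⇒∣-m k∣y)

∣x-y∣x⇒∣y : ∀ {k x y} → k ∣ x - y → k ∣ x → k ∣ y
∣x-y∣x⇒∣y {y = y} k∣x-y k∣x = subst (_ ∣_) (ℤP.neg-involutive y) (ℤD.∣m⇒∣-m (ℤD.∣m+n∣m⇒∣n k∣x-y k∣x))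

pos-^ : ∀ p e → (+ p) ^ e ≡ + (p ℕ.^ e)
pos-^ p zero    = refl
pos-^ p (suc e) = trans (cong (+ p *_) (pos-^ p e)) (sym (ℤP.pos-* p (p ℕ.^ e)))

x∣x^e : ∀ {x e} → 1 ≤ e → x ∣ x ^ e
x∣x^e {x} {suc e} _ = ℤD.∣m⇒∣m*n (x ^ e) ℤD.∣-refl

^-distrib-* : ∀ x y j → (x * y) ^ j ≡ x ^ j * y ^ j
^-distrib-* x y zero    = refl
^-distrib-* x y (suc j) = trans (cong ((x * y) *_) (^-distrib-* x y j)) (regroup x y (x ^ j) (y ^ j))
  where regroup : ∀ x y A B → (x * y) * (A * B) ≡ (x * A) * (y * B)
        regroup = solve-∀

^-mono-∣ : ∀ {x y} j → x ∣ y → x ^ j ∣ y ^ j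
^-mono-∣ zero    _   = ℤD.∣-refl
^-mono-∣ (suc j) x∣y = *-pres-∣ x∣y (^-mono-∣ j x∣y)

pos-^-^ : ∀ p k j → (+ (p ℕ.^ k)) ^ j ≡ (+ p) ^ (k ℕ.* j)
pos-^-^ p k j = trans (cong (_^ j) (sym (pos-^ p k))) (ℤP.^-*-assoc (+ p) k j)

geomSum : ℤ → ℤ → ℕ → ℤ
geomSum X Y zero    = 0ℤ
geomSum X Y (suc t) = X ^ t + Y * geomSum X Y t

pow-difference : ∀ X Y t → X ^ t - Y ^ t ≡ (X - Y) * geomSum X Y t
pow-difference X Y zero    = sym (ℤP.*-zeroʳ (X - Y))
pow-difference X Y (suc t) = begin
    X * X ^ t - Y * Y ^ t
  ≡⟨ split X Y (X ^ t) (Y ^ t) ⟩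
    (X - Y) * X ^ t + Y * (X ^ t - Y ^ t)
  ≡⟨ cong (λ z → (X - Y) * X ^ t + Y * z) (pow-difference X Y t) ⟩
    (X - Y) * X ^ t + Y * ((X - Y) * geomSum X Y t)
  ≡⟨ collect X Y (X ^ t) (geomSum X Y t) ⟩
    (X - Y) * geomSum X Y (suc t)
  ∎
  where
    open ≡-Reasoning
    split : ∀ X Y A B → X * A - Y * B ≡ (X - Y) * A + Y * (A - B)
    split = solve-∀
    collect : ∀ X Y A g → (X - Y) * A + Y * ((X - Y) * g) ≡ (X - Y) * (A + Y * g)
    collect = solve-∀

X-Y∣Xᵗ-Yᵗ : ∀ X Y t → X - Y ∣ X ^ t - Y ^ t
X-Y∣Xᵗ-Yᵗ X Y t = subst (X - Y ∣_) (sym (pow-difference X Y t)) (ℤD.∣m⇒∣m*n _ ℤD.∣-refl)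

-- First-order expansion: modulo X - Y, each term of the geometric sum is X^(t-1),
-- so Σ_{i<t} X^(t-1-i)·Yⁱ ≡ t·X^(t-1).
geomSum-first-order : ∀ {k} X Y t → k ∣ X - Y → k ∣ geomSum X Y (suc t) - (+ suc t) * X ^ t
geomSum-first-order X Y zero _ = divides 0ℤ (vanish Y)
  where vanish : ∀ Y → (1ℤ + Y * 0ℤ) - 1ℤ * 1ℤ ≡ 0ℤ
        vanish = solve-∀
geomSum-first-order {k} X Y (suc t) k∣X-Y =
    subst (k ∣_) (sym (regroup X Y (X ^ t) (geomSum X Y (suc t)) (+ suc t)))
      (ℤD.∣m∣n⇒∣m+n (ℤD.∣n⇒∣m*n Y (geomSum-first-order X Y t k∣X-Y))
                    (ℤD.∣n⇒∣m*n (+ suc t * X ^ t) (subst (k ∣_) (negate X Y) (ℤD.∣m⇒∣-m k∣X-Y))))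
  where
    regroup : ∀ X Y A g T → (X * A + Y * g) - (1ℤ + T) * (X * A) ≡ Y * (g - T * A) + T * A * (Y - X)
    regroup = solve-∀
    negate : ∀ X Y → - (X - Y) ≡ Y - X
    negate = solve-∀

-- Second-order expansion: modulo (X - Y)², for a sum of length s = 2 + t,
-- 2·Σ_{i<s} X^(s-1-i)·Yⁱ ≡ 2s·X^(s-1) - s(s-1)·X^(s-2)·(X - Y). The defect is the difference.
secondOrderDefect : ℤ → ℤ → ℕ → ℤ
secondOrderDefect X Y t =
  (+ 2) * geomSum X Y (2 ℕ.+ t) - (+ 2) * (+ (2 ℕ.+ t)) * X ^ (1 ℕ.+ t)
    + (+ (2 ℕ.+ t)) * (+ (1 ℕ.+ t)) * X ^ t * (X - Y)

geomSum-second-order : ∀ {k} X Y t → k ∣ X - Y → k * k ∣ secondOrderDefect X Y t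
geomSum-second-order X Y zero _ = divides 0ℤ (vanish X Y)
  where vanish : ∀ X Y → (+ 2) * (X * 1ℤ + Y * (1ℤ + Y * 0ℤ)) - (+ 2) * (+ 2) * (X * 1ℤ)
                           + (+ 2) * (+ 1) * 1ℤ * (X - Y) ≡ 0ℤ
        vanish = solve-∀
geomSum-second-order {k} X Y (suc t) k∣X-Y =
    subst (k * k ∣_) (sym (recurrence X Y (X ^ t) (geomSum X Y (2 ℕ.+ t)) (+ suc t)))
      (ℤD.∣m∣n⇒∣m+n (ℤD.∣n⇒∣m*n Y (geomSum-second-order X Y t k∣X-Y))
                    (ℤD.∣n⇒∣m*n ((+ (2 ℕ.+ t)) * (+ suc t) * X ^ t) (*-pres-∣ k∣X-Y k∣X-Y)))
  where
    recurrence : ∀ X Y A g T →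
      (+ 2) * (X * (X * A) + Y * g) - (+ 2) * (1ℤ + (1ℤ + T)) * (X * (X * A))
        + (1ℤ + (1ℤ + T)) * (1ℤ + T) * (X * A) * (X - Y)
      ≡ Y * ((+ 2) * g - (+ 2) * (1ℤ + T) * (X * A) + (1ℤ + T) * T * A * (X - Y))
        + (1ℤ + T) * T * A * ((X - Y) * (X - Y))
    recurrence = solve-∀

_∥_ : ℤ → ℤ → Set
P ∥ g = ∃[ u ] g ≡ P * u × ¬ P ∣ u

module _ {p : ℕ} (pp : Prime p) where

  private
    P : ℤ
    P = + p

  -- P is non-zero, so it can be cancelled from divisibilities.
  instance
    prime≢0 : ℤ.NonZero P
    prime≢0 with prime≡2+ pp
    ... | _ , refl = _

  prime-euclid : ∀ x y → P ∣ x * y → P ∣ x ⊎ P ∣ y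
  prime-euclid x y P∣xy with euclidsLemma ℤ.∣ x ∣ ℤ.∣ y ∣ pp (subst (p ∣ₙ_) (ℤP.abs-* x y) (ℤD.∣⇒∣ᵤ P∣xy))
  ... | inj₁ p∣x = inj₁ (ℤD.∣ᵤ⇒∣ p∣x)
  ... | inj₂ p∣y = inj₂ (ℤD.∣ᵤ⇒∣ p∣y)

  prime∤1 : ¬ P ∣ 1ℤ
  prime∤1 P∣1 with prime≡2+ pp
  ... | _ , refl with ℕD.∣1⇒≡1 (ℤD.∣⇒∣ᵤ P∣1)
  ... | ()

  prime∣^⇒∣ : ∀ x n → P ∣ x ^ n → P ∣ x
  prime∣^⇒∣ x zero    P∣1   = ⊥-elim (prime∤1 P∣1)
  prime∣^⇒∣ x (suc n) P∣xxⁿ with prime-euclid x (x ^ n) P∣xxⁿ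
  ... | inj₁ P∣x  = P∣x
  ... | inj₂ P∣xⁿ = prime∣^⇒∣ x n P∣xⁿ

  cancel-coprime : ∀ {u} → ¬ P ∣ u → ∀ e z → P ^ e ∣ z * u → P ^ e ∣ z
  cancel-coprime P∤u zero    z _ = divides z (sym (ℤP.*-identityʳ z))
  cancel-coprime {u} P∤u (suc e) z P^e+1∣zu with prime-euclid z u (ℤD.∣-trans (x∣x^e {P} {suc e} (s≤s z≤n)) P^e+1∣zu)
  ... | inj₂ P∣u = ⊥-elim (P∤u P∣u)
  ... | inj₁ (divides q z≡qP) =
      subst (P * P ^ e ∣_) (sym (trans z≡qP (ℤP.*-comm q P))) (ℤD.*-monoʳ-∣ P P^e∣q)
    where
      P^e∣q : P ^ e ∣ q
      P^e∣q = cancel-coprime P∤u e q (ℤD.*-cancelˡ-∣ P (subst (P * P ^ e ∣_) (trans (cong (_* u) z≡qP) (swap q P u)) P^e+1∣zu))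
        where swap : ∀ q P u → q * P * u ≡ P * (q * u)
              swap = solve-∀

  cancel-exact : ∀ {g} → P ∥ g → ∀ e z → P ^ suc e ∣ z * g → P ^ e ∣ z
  cancel-exact (u , refl , P∤u) e z P^e+1∣zPu =
    cancel-coprime P∤u e z (ℤD.*-cancelˡ-∣ P (subst (P * P ^ e ∣_) (swap z P u) P^e+1∣zPu))
    where swap : ∀ z P u → z * (P * u) ≡ P * (z * u)
          swap = solve-∀

  coprime-product : ∀ {x E Z} → ¬ P ∣ x → x ∣ Z → P ^ E ∣ Z → x * P ^ E ∣ Z
  coprime-product {x} {E} P∤x (divides q refl) Pᴱ∣qx =
    subst (x * P ^ E ∣_) (ℤP.*-comm x q) (ℤD.*-monoʳ-∣ x (cancel-coprime P∤x E q Pᴱ∣qx))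

  -- If P | X - Y then P divides the geometric sum of length p ...
  geomSum-prime : ∀ X Y → P ∣ X - Y → P ∣ geomSum X Y p
  geomSum-prime X Y P∣X-Y with prime≡2+ pp
  ... | m , refl = ∣x-y∣y⇒∣x (geomSum-first-order X Y (suc m) P∣X-Y) (ℤD.∣m⇒∣m*n (X ^ suc m) ℤD.∣-refl)

  -- ... but not one whose length t is prime to p, as the sum is then ≡ t·X^(t-1).
  geomSum-coprime : ∀ X Y t → P ∣ X - Y → ¬ P ∣ X → p ∤ₙ t → ¬ P ∣ geomSum X Y t
  geomSum-coprime X Y zero    _ _ p∤0 _ = p∤0 (ℕD._∣0 p)
  geomSum-coprime X Y (suc t) P∣X-Y P∤X p∤t P∣G =
    [ (λ P∣t → p∤t (ℤD.∣⇒∣ᵤ P∣t)) , (λ P∣Xᵗ → P∤X (prime∣^⇒∣ X t P∣Xᵗ)) ]′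
      (prime-euclid (+ suc t) (X ^ t) (∣x-y∣x⇒∣y (geomSum-first-order X Y t P∣X-Y) P∣G))

  exact-from-square : ∀ g W → P * P ∣ (+ 2) * g - (+ 2) * P * W → ¬ P ∣ + 2 → ¬ P ∣ W → P ∥ g
  exact-from-square g W P²∣ P∤2 P∤W = u , g≡Pu , P∤u
    where
      cancel-2 : ∀ {z} → P ∣ (+ 2) * z → P ∣ z
      cancel-2 {z} P∣2z with prime-euclid (+ 2) z P∣2z
      ... | inj₁ P∣2 = ⊥-elim (P∤2 P∣2)
      ... | inj₂ P∣z = P∣z
      P∣g : P ∣ g
      P∣g = cancel-2 (∣x-y∣y⇒∣x (ℤD.∣-trans (ℤD.∣m⇒∣m*n P ℤD.∣-refl) P²∣) (ℤD.∣m⇒∣m*n W (ℤD.∣n⇒∣m*n (+ 2) ℤD.∣-refl)))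
      u = ℤD.quotient P∣g
      g≡Pu : g ≡ P * u
      g≡Pu = trans (ℤD._∣_.equality P∣g) (ℤP.*-comm u P)
      factor : ∀ P u W → (+ 2) * (P * u) - (+ 2) * P * W ≡ P * ((+ 2) * (u - W))
      factor = solve-∀
      P∣u-W : P ∣ u - W
      P∣u-W = cancel-2 (ℤD.*-cancelˡ-∣ P (subst (P * P ∣_) (trans (cong (λ z → (+ 2) * z - (+ 2) * P * W) g≡Pu) (factor P u W)) P²∣))
      P∤u : ¬ P ∣ u
      P∤u P∣u = P∤W (∣x-y∣x⇒∣y P∣u-W P∣u)

  geomSum-exact : 2 < p → ∀ X Y → P ∣ X - Y → ¬ P ∣ X → P ∥ geomSum X Y p
  geomSum-exact 2<p X Y P∣X-Y P∤X with prime≡2+ pp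
  ... | m , refl = exact-from-square (geomSum X Y (2 ℕ.+ m)) (X ^ suc m) P²∣ P∤2 (λ P∣W → P∤X (prime∣^⇒∣ X (suc m) P∣W))
    where
      P∤2 : ¬ P ∣ + 2
      P∤2 P∣2 = ℕP.<⇒≱ 2<p (ℕD.∣⇒≤ (ℤD.∣⇒∣ᵤ P∣2))
      P²∣ : P * P ∣ (+ 2) * geomSum X Y (2 ℕ.+ m) - (+ 2) * P * X ^ suc m
      P²∣ = ℤD.∣m+n∣n⇒∣m (geomSum-second-order X Y m P∣X-Y)
              (*-pres-∣ {P} {P} {P * (+ suc m) * X ^ m} {X - Y}
                 (ℤD.∣m⇒∣m*n (X ^ m) (ℤD.∣m⇒∣m*n (+ suc m) ℤD.∣-refl)) P∣X-Y)

odd-form : ∀ c → ¬ (+ 2 ∣ c) → ∃[ s ] c ≡ 1ℤ + (+ 2) * s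
odd-form c 2∤c = byRemainder (c ℤ/.%ℕ 2) refl (ℤ/.n%ℕd<d c 2)
  where
    q = c ℤ/./ℕ 2
    byRemainder : ∀ r → c ℤ/.%ℕ 2 ≡ r → r < 2 → ∃[ s ] c ≡ 1ℤ + (+ 2) * s
    byRemainder r c%2≡r _ with trans (ℤ/.a≡a%ℕn+[a/ℕn]*n c 2) (cong (λ r → + r + q * + 2) c%2≡r)
    byRemainder zero          _ _ | c≡2q = ⊥-elim (2∤c (divides q (trans c≡2q (ℤP.+-identityˡ _))))
    byRemainder (suc zero)    _ _ | c≡1+2q = q , trans c≡1+2q (cong (λ x → 1ℤ + x) (ℤP.*-comm q (+ 2)))
    byRemainder (suc (suc _)) _ (s≤s (s≤s ())) | _

2∤1+2w : ∀ w → ¬ (+ 2 ∣ 1ℤ + (+ 2) * w)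
2∤1+2w w 2∣1+2w = prime∤1 prime[2] (ℤD.∣m+n∣n⇒∣m 2∣1+2w (ℤD.∣m⇒∣m*n w (ℤD.∣-refl {+ 2})))

-- For odd c and d, c² + d² ≡ 2 (mod 4): 2 divides it exactly once.
geomSum-exact-two : ∀ c d → ¬ (+ 2 ∣ c) → ¬ (+ 2 ∣ d) → (+ 2) ∥ geomSum (c ^ 2) (d ^ 2) 2
geomSum-exact-two c d 2∤c 2∤d with odd-form c 2∤c | odd-form d 2∤d
... | s , refl | t , refl = 1ℤ + (+ 2) * w , sumOfSquares s t , 2∤1+2w w
  where
    w = s + s * s + t + t * t
    -- geomSum (c ^ 2) (d ^ 2) 2 unfolds to c²·1 + d²·(1 + d²·0)
    sumOfSquares : ∀ s t → let c = 1ℤ + (+ 2) * s ; d = 1ℤ + (+ 2) * t in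
                           c * (c * 1ℤ) * 1ℤ + d * (d * 1ℤ) * (1ℤ + d * (d * 1ℤ) * 0ℤ)
                           ≡ (+ 2) * (1ℤ + (+ 2) * (s + s * s + t + t * t))
    sumOfSquares = solve-∀

-- Fermat's little theorem over ℤ: p | xᵖ - x, reduced to ℕ through the remainder of x mod p.
fermat-ℤ : ∀ {p} → Prime p → ∀ x → + p ∣ x ^ p - x
fermat-ℤ {p} pp x = viaRemainder (fermat pp r)
  where
    instance _ = ℕ.nonTrivial⇒nonZero p {{prime⇒nonTrivial pp}}
    r = x ℤ/.%ℕ p
    cancel : ∀ r y → (r + y) - r ≡ y
    cancel = solve-∀
    p∣x-r : + p ∣ x - + r
    p∣x-r = divides (x ℤ/./ℕ p) (trans (cong (_- + r) (ℤ/.a≡a%ℕn+[a/ℕn]*n x p)) (cancel (+ r) _))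
    regroup : ∀ A B r x → A - x ≡ ((A - B) + (B - r)) - (x - r)
    regroup = solve-∀
    viaRemainder : ∃[ w ] p ∣ₙ w × r ℕ.^ p ≡ r ℕ.+ w → + p ∣ x ^ p - x
    viaRemainder (w , p∣w , rᵖ≡r+w) =
      subst (+ p ∣_) (sym (regroup (x ^ p) ((+ r) ^ p) (+ r) x))
        (ℤD.∣m∣n⇒∣m-n (ℤD.∣m∣n⇒∣m+n (ℤD.∣-trans p∣x-r (X-Y∣Xᵗ-Yᵗ x (+ r) p))
                                    (subst (+ p ∣_) (sym rᵖ-r≡w) (ℤD.∣ᵤ⇒∣ p∣w)))
                      p∣x-r)
      where
        rᵖ-r≡w : (+ r) ^ p - + r ≡ + w
        rᵖ-r≡w = trans (cong (_- + r) (trans (pos-^ r p) (trans (cong +_ rᵖ≡r+w) (ℤP.pos-+ r w))))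
                       (cancel (+ r) (+ w))

M*pᵏ*p≡M*pᵏ⁺¹ : ∀ M p k → M ℕ.* p ℕ.^ k ℕ.* p ≡ M ℕ.* p ℕ.^ suc k
M*pᵏ*p≡M*pᵏ⁺¹ M p k = trans (ℕP.*-assoc M (p ℕ.^ k) p) (cong (M ℕ.*_) (ℕP.*-comm (p ℕ.^ k) p))

module Powers (a b : ℤ) where

  D : ℕ → ℤ
  D m = a ^ m - b ^ m

  D-factor : ∀ m t → D (m ℕ.* t) ≡ D m * geomSum (a ^ m) (b ^ m) t
  D-factor m t = trans (cong₂ _-_ (sym (ℤP.^-*-assoc a m t)) (sym (ℤP.^-*-assoc b m t)))
                       (pow-difference (a ^ m) (b ^ m) t)

  D-∣ : ∀ {m n} → m ∣ₙ n → D m ∣ D n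
  D-∣ {m} (ℕD.divides t refl) =
    subst (λ n → D m ∣ D n) (ℕP.*-comm m t)
      (subst (D m ∣_) (sym (D-factor m t)) (ℤD.∣m⇒∣m*n (geomSum (a ^ m) (b ^ m) t) ℤD.∣-refl))

  D-addition : ∀ d u → D (d ℕ.+ u) ≡ a ^ d * D u + b ^ u * D d
  D-addition d u = trans (cong₂ _-_ (ℤP.^-distribˡ-+-* a d u) (ℤP.^-distribˡ-+-* b d u))
                         (regroup (a ^ d) (a ^ u) (b ^ d) (b ^ u))
    where regroup : ∀ A B C E → A * B - C * E ≡ A * (B - E) + E * (A - C)
          regroup = solve-∀

  module _ {p : ℕ} (pp : Prime p) where

    private
      P : ℤ
      P = + p

    lift : ∀ e M → P ^ e ∣ D M → P ∣ D M → P ^ suc e ∣ D (M ℕ.* p)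
    lift e M P^e∣DM P∣DM =
      subst (P * P ^ e ∣_) (sym (D-factor M p))
        (subst (_∣ D M * geomSum (a ^ M) (b ^ M) p) (ℤP.*-comm (P ^ e) P)
          (*-pres-∣ P^e∣DM (geomSum-prime pp (a ^ M) (b ^ M) P∣DM)))

    lift-power : ∀ k e M → 1 ≤ e → P ^ e ∣ D M → P ^ (e ℕ.+ k) ∣ D (M ℕ.* p ℕ.^ k)
    lift-power zero e M _ Pᵉ∣DM =
      subst₂ (λ u v → P ^ u ∣ D v) (sym (ℕP.+-identityʳ e)) (sym (ℕP.*-identityʳ M)) Pᵉ∣DM
    lift-power (suc k) (suc e) M 1≤e Pᵉ∣DM =
      subst₂ (λ u v → P ^ u ∣ D v) (sym (ℕP.+-suc (suc e) k)) (M*pᵏ*p≡M*pᵏ⁺¹ M p k)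
        (lift (suc e ℕ.+ k) (M ℕ.* p ℕ.^ k) IH (ℤD.∣-trans (x∣x^e {P} {suc e ℕ.+ k} (s≤s z≤n)) IH))
      where IH = lift-power k (suc e) M 1≤e Pᵉ∣DM

    drop-coprime : ∀ e M t → ¬ P ∣ a → P ∣ D M → p ∤ₙ t → P ^ e ∣ D (M ℕ.* t) → P ^ e ∣ D M
    drop-coprime e M t P∤a P∣DM p∤t P^e∣DMt =
      cancel-coprime pp (geomSum-coprime pp (a ^ M) (b ^ M) t P∣DM (λ P∣aᴹ → P∤a (prime∣^⇒∣ pp a M P∣aᴹ)) p∤t)
        e (D M) (subst (P ^ e ∣_) (D-factor M t) P^e∣DMt)

    descend : ∀ k e M → (∀ i → P ∥ geomSum (a ^ (M ℕ.* p ℕ.^ i)) (b ^ (M ℕ.* p ℕ.^ i)) p) →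
              P ^ (e ℕ.+ k) ∣ D (M ℕ.* p ℕ.^ k) → P ^ e ∣ D M
    descend zero e M _ P^e∣DM =
      subst₂ (λ u v → P ^ u ∣ D v) (ℕP.+-identityʳ e) (ℕP.*-identityʳ M) P^e∣DM
    descend (suc k) e M exact P^e+k+1∣ =
      descend k e M exact
        (cancel-exact pp (exact k) (e ℕ.+ k) (D (M ℕ.* p ℕ.^ k))
          (subst (P ^ suc (e ℕ.+ k) ∣_) (D-factor (M ℕ.* p ℕ.^ k) p)
            (subst₂ (λ u v → P ^ u ∣ D v) (ℕP.+-suc e k) (sym (M*pᵏ*p≡M*pᵏ⁺¹ M p k)) P^e+k+1∣)))

module Coprime (a b : ℤ) (coprime : ℤG.gcd a b ≡ 1ℤ) where

  open Powers a b

  module _ {p : ℕ} (pp : Prime p) where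

    private
      P : ℤ
      P = + p

    ¬common-factor : P ∣ a → P ∣ b → ⊥
    ¬common-factor P∣a P∣b =
      prime∤1 pp (ℤD.∣ᵤ⇒∣ (subst (P ℤU.∣_) coprime (ℤG.gcd-greatest {a} {b} {P} (ℤD.∣⇒∣ᵤ P∣a) (ℤD.∣⇒∣ᵤ P∣b))))

    ∣D⇒∤a : ∀ {n} → 1 ≤ n → P ∣ D n → ¬ P ∣ a
    ∣D⇒∤a {suc n} _ P∣D P∣a = ¬common-factor P∣a
      (prime∣^⇒∣ pp b (suc n) (∣x-y∣x⇒∣y P∣D (ℤD.∣m⇒∣m*n (a ^ n) P∣a)))

    ∣D⇒∤b : ∀ {n} → 1 ≤ n → P ∣ D n → ¬ P ∣ b
    ∣D⇒∤b {suc n} _ P∣D P∣b = ¬common-factor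
      (prime∣^⇒∣ pp a (suc n) (∣x-y∣y⇒∣x P∣D (ℤD.∣m⇒∣m*n (b ^ n) P∣b))) P∣b

    module _ (P∤a : ¬ P ∣ a) (P∤b : ¬ P ∣ b) where

      D-difference : ∀ d u → P ∣ D (d ℕ.+ u) → P ∣ D u → P ∣ D d
      D-difference d u P∣Dd+u P∣Du =
        [ (λ P∣bᵘ → ⊥-elim (P∤b (prime∣^⇒∣ pp b u P∣bᵘ))) , id ]′ (prime-euclid pp (b ^ u) (D d) P∣bᵘDd)
        where
          P∣bᵘDd : P ∣ b ^ u * D d
          P∣bᵘDd = ℤD.∣m+n∣m⇒∣n (subst (P ∣_) (D-addition d u) P∣Dd+u) (ℤD.∣n⇒∣m*n (a ^ d) P∣Du)

      D-gcd : ∀ m n → P ∣ D m → P ∣ D n → P ∣ D (ℕG.gcd m n)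
      D-gcd m n P∣Dm P∣Dn = byBézout (ℕG.Bézout.identity (ℕG.gcd-GCD m n))
        where
          g = ℕG.gcd m n
          byBézout : ℕG.Bézout.Identity g m n → P ∣ D g
          byBézout (ℕG.Bézout.+- x y g+yn≡xm) =
            D-difference g (y ℕ.* n) (subst (λ z → P ∣ D z) (sym g+yn≡xm) (ℤD.∣-trans P∣Dm (D-∣ (ℕD.n∣m*n x))))
              (ℤD.∣-trans P∣Dn (D-∣ (ℕD.n∣m*n y)))
          byBézout (ℕG.Bézout.-+ x y g+xm≡yn) =
            D-difference g (x ℕ.* m) (subst (λ z → P ∣ D z) (sym g+xm≡yn) (ℤD.∣-trans P∣Dn (D-∣ (ℕD.n∣m*n y))))
              (ℤD.∣-trans P∣Dm (D-∣ (ℕD.n∣m*n x)))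

      D-fermat : P ∣ D (p ℕ.∸ 1)
      D-fermat with prime≡2+ pp
      ... | m , refl = subst (P ∣_) (cancel (a ^ suc m) (b ^ suc m)) (ℤD.∣m∣n⇒∣m-n (unit a P∤a) (unit b P∤b))
        where
          cancel : ∀ A B → (A - 1ℤ) - (B - 1ℤ) ≡ A - B
          cancel = solve-∀
          factor : ∀ x A → x * A - x ≡ x * (A - 1ℤ)
          factor = solve-∀
          unit : ∀ x → ¬ P ∣ x → P ∣ x ^ suc m - 1ℤ
          unit x P∤x = [ ⊥-elim ∘ P∤x , id ]′
            (prime-euclid pp x (x ^ suc m - 1ℤ) (subst (P ∣_) (factor x (x ^ suc m)) (fermat-ℤ pp x)))

      D-order : ∀ n → P ∣ D n → P ∣ D (ℕG.gcd n (p ℕ.∸ 1))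
      D-order n P∣Dn = D-gcd n (p ℕ.∸ 1) P∣Dn D-fermat

      descend-odd : 2 < p → ∀ k e M → P ∣ D M → P ^ (e ℕ.+ k) ∣ D (M ℕ.* p ℕ.^ k) → P ^ e ∣ D M
      descend-odd 2<p k e M P∣DM = descend pp k e M exact
        where
          exact : ∀ i → P ∥ geomSum (a ^ (M ℕ.* p ℕ.^ i)) (b ^ (M ℕ.* p ℕ.^ i)) p
          exact i = geomSum-exact pp 2<p (a ^ (M ℕ.* p ℕ.^ i)) (b ^ (M ℕ.* p ℕ.^ i))
                      (ℤD.∣-trans P∣DM (D-∣ (ℕD.m∣m*n {M} (p ℕ.^ i))))
                      (λ P∣aᴹᵖⁱ → P∤a (prime∣^⇒∣ pp a (M ℕ.* p ℕ.^ i) P∣aᴹᵖⁱ))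

module TwoAdic (a b : ℤ) (coprime : ℤG.gcd a b ≡ 1ℤ) where

  open Powers a b
  open Coprime a b coprime

  private
    two : ℤ
    two = + 2

  odd-power : ∀ {x} n → ¬ two ∣ x → ¬ two ∣ x ^ n
  odd-power {x} n 2∤x 2∣xⁿ = 2∤x (prime∣^⇒∣ prime[2] x n 2∣xⁿ)

  descend-two : ¬ two ∣ a → ¬ two ∣ b → ∀ k e → two ^ (e ℕ.+ k) ∣ D (2 ℕ.* 2 ℕ.^ k) → two ^ e ∣ D 2
  descend-two 2∤a 2∤b k e = descend prime[2] k e 2 exact
    where
      square : ∀ x i → x ^ (2 ℕ.* 2 ℕ.^ i) ≡ (x ^ (2 ℕ.^ i)) ^ 2
      square x i = trans (cong (x ^_) (ℕP.*-comm 2 (2 ℕ.^ i))) (sym (ℤP.^-*-assoc x (2 ℕ.^ i) 2))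
      exact : ∀ i → two ∥ geomSum (a ^ (2 ℕ.* 2 ℕ.^ i)) (b ^ (2 ℕ.* 2 ℕ.^ i)) 2
      exact i = subst₂ (λ A B → two ∥ geomSum A B 2) (sym (square a i)) (sym (square b i))
        (geomSum-exact-two (a ^ (2 ℕ.^ i)) (b ^ (2 ℕ.^ i)) (odd-power (2 ℕ.^ i) 2∤a) (odd-power (2 ℕ.^ i) 2∤b))

  private
    X Y g L : ℕ
    X = ℤ.∣ a - b ∣
    Y = ℤ.∣ a + b ∣
    g = ℕG.gcd X Y
    L = ℕL.lcm X Y

  |D2|≡gcd*lcm : ℤ.∣ D 2 ∣ ≡ g ℕ.* L
  |D2|≡gcd*lcm = trans (cong ℤ.∣_∣ (factor a b)) (trans (ℤP.abs-* (a - b) (a + b)) (sym (ℕL.gcd*lcm X Y)))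
    where factor : ∀ a b → a * (a * 1ℤ) - b * (b * 1ℤ) ≡ (a - b) * (a + b)
          factor = solve-∀

  |2^e|≡2^e : ∀ e → ℤ.∣ two ^ e ∣ ≡ 2 ℕ.^ e
  |2^e|≡2^e e = cong ℤ.∣_∣ (pos-^ 2 e)

  -- Since (a + b) ± (a - b) ∈ {2a, 2b} and gcd(a, b) = 1, gcd(|a - b|, |a + b|) divides 2.
  gcd∣2 : g ∣ₙ 2
  gcd∣2 = subst (g ∣ₙ_) gcd[2a,2b]≡2 (ℕG.gcd-greatest g∣2a g∣2b)
    where
      g∣a-b : + g ∣ a - b
      g∣a-b = ℤD.∣ᵤ⇒∣ (ℕG.gcd[m,n]∣m X Y)
      g∣a+b : + g ∣ a + b
      g∣a+b = ℤD.∣ᵤ⇒∣ (ℕG.gcd[m,n]∣n X Y)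
      sum : ∀ a b → (a - b) + (a + b) ≡ two * a
      sum = solve-∀
      difference : ∀ a b → (a + b) - (a - b) ≡ two * b
      difference = solve-∀
      g∣2a : g ∣ₙ 2 ℕ.* ℤ.∣ a ∣
      g∣2a = subst (g ∣ₙ_) (ℤP.abs-* two a) (ℤD.∣⇒∣ᵤ (subst (+ g ∣_) (sum a b) (ℤD.∣m∣n⇒∣m+n g∣a-b g∣a+b)))
      g∣2b : g ∣ₙ 2 ℕ.* ℤ.∣ b ∣
      g∣2b = subst (g ∣ₙ_) (ℤP.abs-* two b) (ℤD.∣⇒∣ᵤ (subst (+ g ∣_) (difference a b) (ℤD.∣m∣n⇒∣m-n g∣a+b g∣a-b)))
      gcd[2a,2b]≡2 : ℕG.gcd (2 ℕ.* ℤ.∣ a ∣) (2 ℕ.* ℤ.∣ b ∣) ≡ 2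
      gcd[2a,2b]≡2 = trans (sym (ℕG.c*gcd[m,n]≡gcd[cm,cn] 2 ℤ.∣ a ∣ ℤ.∣ b ∣)) (cong (2 ℕ.*_) (cong ℤ.∣_∣ coprime))

  -- 2^(e+1) | D 2 forces 2^e | lcm(a - b, a + b) ...
  D2⇒lcm : ∀ e → two ^ suc e ∣ D 2 → two ^ e ℤU.∣ lcm (a - b) (a + b)
  D2⇒lcm e 2^e+1∣D2 = subst (ℕD._∣ L) (sym (|2^e|≡2^e e)) (ℕD.*-cancelˡ-∣ 2 2^e+1∣2L)
    where
      2^e+1∣2L : 2 ℕ.* 2 ℕ.^ e ∣ₙ 2 ℕ.* L
      2^e+1∣2L = ℕD.∣-trans (subst₂ _∣ₙ_ (|2^e|≡2^e (suc e)) |D2|≡gcd*lcm (ℤD.∣⇒∣ᵤ 2^e+1∣D2)) (ℕD.*-monoˡ-∣ L gcd∣2)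

  -- ... and conversely when a and b are odd, since then 2 | gcd(|a - b|, |a + b|).
  lcm⇒D2 : ¬ two ∣ a → ¬ two ∣ b → ∀ e → two ^ e ℤU.∣ lcm (a - b) (a + b) → two ^ suc e ∣ D 2
  lcm⇒D2 2∤a 2∤b e 2^e∣L =
    ℤD.∣ᵤ⇒∣ (subst₂ _∣ₙ_ (sym (|2^e|≡2^e (suc e))) (sym |D2|≡gcd*lcm)
      (ℕD.*-pres-∣ (ℕG.gcd-greatest (ℤD.∣⇒∣ᵤ 2∣a-b) (ℤD.∣⇒∣ᵤ 2∣a+b)) (subst (ℕD._∣ L) (|2^e|≡2^e e) 2^e∣L)))
    where
      2∣a-b : two ∣ a - b
      2∣a-b with odd-form a 2∤a | odd-form b 2∤b
      ... | s , refl | t , refl = divides (s - t) (even s t)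
        where even : ∀ s t → (1ℤ + two * s) - (1ℤ + two * t) ≡ (s - t) * two
              even = solve-∀
      2∣a+b : two ∣ a + b
      2∣a+b = subst (two ∣_) (shift a b) (ℤD.∣m∣n⇒∣m+n 2∣a-b (ℤD.∣m⇒∣m*n b (ℤD.∣-refl {two})))
        where shift : ∀ a b → (a - b) + two * b ≡ a + b
              shift = solve-∀

  lcm-even⇒odd : two ℤU.∣ lcm (a - b) (a + b) → ¬ two ∣ a × ¬ two ∣ b
  lcm-even⇒odd 2∣L = 2∤a , 2∤b
    where
      2∣a-b : two ∣ a - b
      2∣a-b with euclidsLemma X Y prime[2] (ℕD.∣-trans 2∣L (subst (L ∣ₙ_) (ℕL.gcd*lcm X Y) (ℕD.n∣m*n g)))
      ... | inj₁ 2∣X = ℤD.∣ᵤ⇒∣ 2∣X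
      ... | inj₂ 2∣Y = subst (two ∣_) (shift a b) (ℤD.∣m∣n⇒∣m-n (ℤD.∣ᵤ⇒∣ {two} {a + b} 2∣Y) (ℤD.∣m⇒∣m*n b (ℤD.∣-refl {two})))
        where shift : ∀ a b → (a + b) - two * b ≡ a - b
              shift = solve-∀
      2∤a : ¬ two ∣ a
      2∤a 2∣a = ¬common-factor prime[2] 2∣a (∣x-y∣x⇒∣y 2∣a-b 2∣a)
      2∤b : ¬ two ∣ b
      2∤b 2∣b = ¬common-factor prime[2] (∣x-y∣y⇒∣x 2∣a-b 2∣b) 2∣b

exponent-split : ∀ j k → 1 ≤ j → (j ℕ.∸ 1) ℕ.* k ℕ.+ k ≡ k ℕ.* j
exponent-split (suc j) k _ = rearrange j k
  where rearrange : ∀ j k → j ℕ.* k ℕ.+ k ≡ k ℕ.* suc j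
        rearrange = ℕRing.solve-∀

exponent-positive : ∀ j k → 2 ≤ j → 1 ≤ k → 1 ≤ (j ℕ.∸ 1) ℕ.* k
exponent-positive (suc (suc j)) (suc k) (s≤s (s≤s _)) _ = s≤s z≤n

module Theorem (a b : ℤ) (j : ℕ) (coprime : ℤG.gcd a b ≡ 1ℤ) (2≤j : 2 ≤ j) where

  open Powers a b
  open Coprime a b coprime
  open TwoAdic a b coprime

  private
    1≤j : 1 ≤ j
    1≤j = ℕP.≤-trans (s≤s z≤n) 2≤j

  D1≡a-b : D 1 ≡ a - b
  D1≡a-b = cong₂ _-_ (ℤP.^-identityʳ a) (ℤP.^-identityʳ b)

  1ʲ∣D1 : (+ 1) ^ j ∣ D 1
  1ʲ∣D1 = subst (_∣ D 1) (sym (ℤP.^-zeroˡ j)) (divides (D 1) (sym (ℤP.*-identityʳ (D 1))))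

  -- Sufficiency, one prime power at a time: if mʲ | D m, p ∤ m and p^((j-1)k) | D m,
  -- then lifting gives p^(kj) | D (m·pᵏ), hence (m·pᵏ)ʲ | D (m·pᵏ).
  extend : ∀ {m p k} → Prime p → 1 ≤ k → p ∤ₙ m → (+ m) ^ j ∣ D m → (+ p) ^ ((j ℕ.∸ 1) ℕ.* k) ∣ D m →
           (+ (m ℕ.* p ℕ.^ k)) ^ j ∣ D (m ℕ.* p ℕ.^ k)
  extend {m} {p} {k} pp 1≤k p∤m mʲ∣Dm pᵉ∣Dm =
    subst (_∣ D (m ℕ.* p ℕ.^ k)) (sym mpᵏʲ≡mʲpᵏʲ)
      (coprime-product pp {E = k ℕ.* j} (λ P∣mʲ → p∤m (ℤD.∣⇒∣ᵤ (prime∣^⇒∣ pp (+ m) j P∣mʲ)))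
        (ℤD.∣-trans mʲ∣Dm (D-∣ (ℕD.m∣m*n {m} (p ℕ.^ k))))
        (subst (λ u → (+ p) ^ u ∣ D (m ℕ.* p ℕ.^ k)) (exponent-split j k 1≤j)
          (lift-power pp k ((j ℕ.∸ 1) ℕ.* k) m (exponent-positive j k 2≤j 1≤k) pᵉ∣Dm)))
    where
      mpᵏʲ≡mʲpᵏʲ : (+ (m ℕ.* p ℕ.^ k)) ^ j ≡ (+ m) ^ j * (+ p) ^ (k ℕ.* j)
      mpᵏʲ≡mʲpᵏʲ = trans (cong (_^ j) (ℤP.pos-* m (p ℕ.^ k)))
                     (trans (^-distrib-* (+ m) (+ (p ℕ.^ k)) j) (cong ((+ m) ^ j *_) (pos-^-^ p k j)))

  -- The first prime power when it is a power of 2: the lcm condition gives 2^((j-1)k+1) | D 2,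
  -- and lifting k - 1 times gives 2^(kj) | D (2ᵏ).
  start-two : ∀ k → 1 ≤ k → (+ 2) ^ ((j ℕ.∸ 1) ℕ.* k) ℤU.∣ lcm (a - b) (a + b) → (+ (2 ℕ.^ k)) ^ j ∣ D (2 ℕ.^ k)
  start-two (suc k) 1≤k 2ᵉ∣lcm =
    subst (_∣ D (2 ℕ.^ suc k)) (sym (trans (pos-^-^ 2 (suc k) j) (cong ((+ 2) ^_) exponent)))
      (lift-power prime[2] k (suc e) 2 (s≤s z≤n) (lcm⇒D2 2∤a 2∤b e 2ᵉ∣lcm))
    where
      e = (j ℕ.∸ 1) ℕ.* suc k
      exponent : suc k ℕ.* j ≡ suc e ℕ.+ k
      exponent = trans (sym (exponent-split j (suc k) 1≤j)) (ℕP.+-suc e k)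
      odd = lcm-even⇒odd (ℤD.∣⇒∣ᵤ (ℤD.∣-trans (x∣x^e (exponent-positive j (suc k) 2≤j 1≤k))
                                             (ℤD.∣ᵤ⇒∣ {(+ 2) ^ e} {lcm (a - b) (a + b)} 2ᵉ∣lcm)))
      2∤a = proj₁ odd
      2∤b = proj₂ odd

  sufficiency-from : ∀ {s} m fs → PrimesBelow m s → All (λ pk → s ≤ proj₁ pk) fs →
    All (λ pk → Prime (proj₁ pk) × 1 ≤ proj₂ pk) fs → Linked _<_ (map proj₁ fs) →
    (+ m) ^ j ∣ D m → LaterConditions a b j m fs → (+ (m ℕ.* factorProduct fs)) ^ j ∣ D (m ℕ.* factorProduct fs)
  sufficiency-from m [] _ _ _ _ mʲ∣Dm _ = subst (λ x → (+ x) ^ j ∣ D x) (sym (ℕP.*-identityʳ m)) mʲ∣Dm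
  sufficiency-from m ((p , k) ∷ fs) below (s≤p ∷ _) ((pp , 1≤k) ∷ primePowers) increasing mʲ∣Dm (c , cs) =
    subst (λ x → (+ x) ^ j ∣ D x) (ℕP.*-assoc m (p ℕ.^ k) (factorProduct fs))
      (sufficiency-from (m ℕ.* p ℕ.^ k) fs
        (primesBelow-* (primesBelow-≤ below (ℕP.m≤n⇒m≤1+n s≤p)) pp (ℕP.n<1+n p) k)
        (above-head fs increasing) primePowers (Linked.tail increasing)
        (extend pp 1≤k (primesBelow⇒∤ below pp s≤p) mʲ∣Dm (ℤD.∣ᵤ⇒∣ c)) cs)

  sufficiency : ∀ n fs → IsPrimeFactorization n fs → FactorConditions a b j fs → (+ n) ^ j ∣ D n
  sufficiency n [] (refl , _ , _) _ = 1ʲ∣D1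
  sufficiency n ((p , k) ∷ fs) (refl , (pp , 1≤k) ∷ primePowers , increasing) (c-odd , c-two , cs) =
    sufficiency-from (p ℕ.^ k) fs
      (subst (λ x → PrimesBelow x (suc p)) (ℕP.*-identityˡ (p ℕ.^ k)) (primesBelow-* primesBelow-1 pp (ℕP.n<1+n p) k))
      (above-head fs increasing)
      primePowers (Linked.tail increasing) first cs
    where
      first : (+ (p ℕ.^ k)) ^ j ∣ D (p ℕ.^ k)
      first with ℕP.m≤n⇒m<n∨m≡n (prime>1 pp)
      ... | inj₁ 2<p = subst (λ x → (+ x) ^ j ∣ D x) (ℕP.*-identityˡ (p ℕ.^ k))
                         (extend pp 1≤k (primesBelow⇒∤ primesBelow-1 pp ℕP.≤-refl) 1ʲ∣D1
                           (subst (_ ∣_) (sym D1≡a-b) (ℤD.∣ᵤ⇒∣ (c-odd 2<p))))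
      ... | inj₂ refl = start-two k 1≤k (c-two refl)

  Condition : ℕ → ℕ → ℕ → Set
  Condition m p k = (2 < p → (+ p) ^ ((j ℕ.∸ 1) ℕ.* k) ∣ D m)
                  × (p ≡ 2 → (+ p) ^ ((j ℕ.∸ 1) ℕ.* k) ℤU.∣ lcm (a - b) (a + b))

  -- At p = 2 (necessarily the first prime, so m = 1): 2^(kj) | D (2ᵏ) descends to
  -- 2^((j-1)k+1) | D 2, that is, 2^((j-1)k) | lcm(a - b, a + b).
  necessary-two : ∀ k → 1 ≤ k → ¬ + 2 ∣ a → ¬ + 2 ∣ b → (+ 2) ^ (k ℕ.* j) ∣ D (1 ℕ.* 2 ℕ.^ k) →
                  (+ 2) ^ ((j ℕ.∸ 1) ℕ.* k) ℤU.∣ lcm (a - b) (a + b)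
  necessary-two (suc k) _ 2∤a 2∤b 2ᵏʲ∣D =
    D2⇒lcm e (descend-two 2∤a 2∤b k (suc e)
      (subst₂ (λ u v → (+ 2) ^ u ∣ D v) exponent (ℕP.*-identityˡ (2 ℕ.^ suc k)) 2ᵏʲ∣D))
    where
      e = (j ℕ.∸ 1) ℕ.* suc k
      exponent : suc k ℕ.* j ≡ suc e ℕ.+ k
      exponent = trans (sym (exponent-split j (suc k) 1≤j)) (ℕP.+-suc e k)

  module Necessity (n : ℕ) (1≤n : 1 ≤ n) (nʲ∣Dn : (+ n) ^ j ∣ D n) where

    record LocalDivisibility (m p k : ℕ) : Set where
      field
        p∤a      : ¬ + p ∣ a
        p∤b      : ¬ + p ∣ b
        p∣Dm     : + p ∣ D m
        pᵏʲ∣Dmpᵏ : (+ p) ^ (k ℕ.* j) ∣ D (m ℕ.* p ℕ.^ k)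

    localDivisibility : ∀ {m p k r} → n ≡ m ℕ.* (p ℕ.^ k ℕ.* r) → Prime p → 1 ≤ k → p ∤ₙ r →
                        p Rough (p ℕ.^ k ℕ.* r) → LocalDivisibility m p k
    localDivisibility {m} {p} {k} {r} n≡mpᵏr pp 1≤k p∤r rough = record
      { p∤a = p∤a ; p∤b = p∤b ; p∣Dm = p∣Dm
      ; pᵏʲ∣Dmpᵏ = drop-coprime pp (k ℕ.* j) (m ℕ.* p ℕ.^ k) r p∤a (ℤD.∣-trans p∣Dm (D-∣ (ℕD.m∣m*n {m} (p ℕ.^ k)))) p∤r
                     (subst (λ x → (+ p) ^ (k ℕ.* j) ∣ D x) (trans n≡mpᵏr (sym (ℕP.*-assoc m (p ℕ.^ k) r))) pᵏʲ∣Dn)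
      }
      where
        pᵏ∣n : p ℕ.^ k ∣ₙ n
        pᵏ∣n = subst (_ ∣ₙ_) (sym n≡mpᵏr) (ℕD.∣n⇒∣m*n m (ℕD.m∣m*n r))
        pᵏʲ∣Dn : (+ p) ^ (k ℕ.* j) ∣ D n
        pᵏʲ∣Dn = ℤD.∣-trans (subst (_∣ (+ n) ^ j) (pos-^-^ p k j) (^-mono-∣ j (ℤD.∣ᵤ⇒∣ pᵏ∣n))) nʲ∣Dn
        p∣Dn : + p ∣ D n
        p∣Dn = ℤD.∣-trans (x∣x^e (ℕP.*-mono-≤ 1≤k 1≤j)) pᵏʲ∣Dn
        p∤a = ∣D⇒∤a pp 1≤n p∣Dn
        p∤b = ∣D⇒∤b pp 1≤n p∣Dn
        -- The rank of apparition of p divides gcd(n, p - 1), which divides m.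
        p∣Dm : + p ∣ D m
        p∣Dm = ℤD.∣-trans (D-order pp p∤a p∤b n p∣Dn)
                 (D-∣ (subst (λ x → ℕG.gcd x (p ℕ.∸ 1) ∣ₙ m) (sym n≡mpᵏr) (gcd[mr,p-1]∣m pp rough m)))

    -- The conditions hold at every split n = m·pᵏ·r of the kind produced by sortedFactorisation;
    -- for p = 2 the prefix m consists of smaller primes, so m = 1.
    condition : ∀ {m p k r} → n ≡ m ℕ.* (p ℕ.^ k ℕ.* r) → Prime p → 1 ≤ k → p ∤ₙ r →
                p Rough (p ℕ.^ k ℕ.* r) → PrimesBelow m p → Condition m p k
    condition {m} {p} {k} n≡mpᵏr pp 1≤k p∤r rough below with ℕP.m≤n⇒m<n∨m≡n (prime>1 pp)
    ... | inj₁ 2<p = (λ _ → descend-odd pp p∤a p∤b 2<p k ((j ℕ.∸ 1) ℕ.* k) m p∣Dm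
                               (subst (λ u → (+ p) ^ u ∣ D (m ℕ.* p ℕ.^ k)) (sym (exponent-split j k 1≤j)) pᵏʲ∣Dmpᵏ))
                   , (λ { refl → ⊥-elim (ℕP.<-irrefl refl 2<p) })
      where open LocalDivisibility (localDivisibility {m} n≡mpᵏr pp 1≤k p∤r rough)
    ... | inj₂ refl with primesBelow-2⇒≡1 (1≤m*n⇒1≤m m _ (subst (1 ≤_) n≡mpᵏr 1≤n)) below
    ...   | refl = (λ 2<2 → ⊥-elim (ℕP.<-irrefl refl 2<2)) , (λ _ → necessary-two k 1≤k p∤a p∤b pᵏʲ∣Dmpᵏ)
      where open LocalDivisibility (localDivisibility {m} n≡mpᵏr pp 1≤k p∤r rough)

    laterConditions : ∀ m fs → All (λ pk → 2 < proj₁ pk) fs → PrefixConditions Condition m fs →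
                      LaterConditions a b j m fs
    laterConditions m []             _           _             = tt
    laterConditions m ((p , k) ∷ fs) (2<p ∷ 2<s) ((odd , _) , cs) =
      ℤD.∣⇒∣ᵤ (odd 2<p) , laterConditions (m ℕ.* p ℕ.^ k) fs 2<s cs

    factorConditions : ∀ fs → Linked _<_ (map proj₁ fs) → All (λ pk → 2 ≤ proj₁ pk) fs →
                       PrefixConditions Condition 1 fs → FactorConditions a b j fs
    factorConditions []             _          _         _                  = tt
    factorConditions ((p , k) ∷ fs) increasing (2≤p ∷ _) ((odd , two) , cs) =
        (λ 2<p → ℤD.∣⇒∣ᵤ (subst (_ ∣_) D1≡a-b (odd 2<p)))
      , two
      , laterConditions (p ℕ.^ k) fs (All.map (ℕP.≤-<-trans 2≤p) (above-head fs increasing))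
          (subst (λ m → PrefixConditions Condition m fs) (ℕP.*-identityˡ (p ℕ.^ k)) cs)

    necessity : ∃[ fs ] (IsPrimeFactorization n fs × FactorConditions a b j fs)
    necessity = F.factors , (F.product , F.primePowers , F.increasing)
              , factorConditions F.factors F.increasing F.bounded F.conditions
      where
        module F = SortedFactorisation
          (sortedFactorisation n Condition condition 2 1 n (sym (ℕP.*-identityˡ n)) 1≤n 2-rough primesBelow-1)

theorem2 : (a b : ℤ) (j n : ℕ) → ℤG.gcd a b ≡ 1ℤ → 2 ≤ j → 1 ≤ n →
    ((+ n) ℤ.^ j ℤU.∣ (a ℤ.^ n) ℤ.- (b ℤ.^ n)) ⇔ (∃[ fs ] (IsPrimeFactorization n fs × FactorConditions a b j fs))
theorem2 a b j n coprime 2≤j 1≤n = mk⇔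
  (λ nʲ∣Dn → Necessity.necessity n 1≤n (ℤD.∣ᵤ⇒∣ nʲ∣Dn))
  (λ (fs , factorisation , conditions) → ℤD.∣⇒∣ᵤ (sufficiency n fs factorisation conditions))
  where open Theorem a b j coprime 2≤j
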